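{- Let $\mathbf D=\langle D,+,',1\rangle$ be an algebra of type $(2,1,0)$, put $0=1'$, and suppose $\mathbf D$ satisfies the identities $x''\approx x$; $0+x\approx x$ and $x+1\approx 1$; $x+x'\approx 1$; and $(((z+y)'+(z+x))'+(z+y)')+z'\approx z'$. Let $R$ be the relation on $D$ defined by $(a,b)\in R$ iff $a+b=b$. Then: (i) $0'=1$; (ii) $(x'+y)'+x=x$ for all $x,y\in D$; (iii) $(0,x)\in R$ and $(x,1)\in R$ for every $x\in D$; (iv) if $(x,y)\in R$ then $(y',x')\in R$. -}

module Defs where

open import Level using (Level; suc; _⊔_)
open import Relation.Binary.PropositionalEquality using (_≡_)
open import Data.Product using (_×_)

record Algebra-2-1-0 (a : Level) : Set (suc a) where
  infixl 6 _⊕_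
  field
    Carrier : Set a
    _⊕_     : Carrier → Carrier → Carrier
    _′      : Carrier → Carrier
    𝟏       : Carrier

  𝟎 : Carrier
  𝟎 = 𝟏 ′

  R : Carrier → Carrier → Set a
  R x y = x ⊕ y ≡ y

record Satisfies-Axioms {a : Level} (D : Algebra-2-1-0 a) : Set a where
  open Algebra-2-1-0 D
  field
    double-neg : ∀ x → (x ′) ′ ≡ x
    zero-left  : ∀ x → 𝟎 ⊕ x ≡ x
    one-right  : ∀ x → x ⊕ 𝟏 ≡ 𝟏
    compl      : ∀ x → x ⊕ (x ′) ≡ 𝟏
    ax5        : ∀ x y z →
                 ((((z ⊕ y) ′ ⊕ (z ⊕ x)) ′ ⊕ (z ⊕ y) ′) ⊕ z ′) ≡ z ′

module Submission where

open import Defs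
open import Level using (Level)
open import Data.Product using (_×_; _,_)
open import Relation.Binary.PropositionalEquality using (_≡_; cong; sym; module ≡-Reasoning)

module _ {a : Level} (D : Algebra-2-1-0 a) (axioms : Satisfies-Axioms D) where
  open Algebra-2-1-0 D
  open Satisfies-Axioms axioms
  open ≡-Reasoning

  𝟎′≡𝟏 : 𝟎 ′ ≡ 𝟏
  𝟎′≡𝟏 = double-neg 𝟏

  compl-left : ∀ x → x ′ ⊕ x ≡ 𝟏
  compl-left x = begin
    x ′ ⊕ x       ≡⟨ cong (x ′ ⊕_) (sym (double-neg x)) ⟩
    x ′ ⊕ x ′ ′   ≡⟨ compl (x ′) ⟩
    𝟏             ∎

  -- ax5 at z = x′: the inner summand z ⊕ x collapses to 𝟏, so the whole
  -- left bracket reduces to (x′ ⊕ y)′.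
  absorption : ∀ x y → (x ′ ⊕ y) ′ ⊕ x ≡ x
  absorption x y = begin
    u ⊕ x                          ≡⟨ cong (u ⊕_) (sym (double-neg x)) ⟩
    u ⊕ x ′ ′                      ≡⟨ cong (_⊕ x ′ ′) (sym bracket≡u) ⟩
    ((u ⊕ (x ′ ⊕ x)) ′ ⊕ u) ⊕ x ′ ′ ≡⟨ ax5 x y (x ′) ⟩
    x ′ ′                          ≡⟨ double-neg x ⟩
    x                              ∎
    where
    u : Carrier
    u = (x ′ ⊕ y) ′
    bracket≡u : (u ⊕ (x ′ ⊕ x)) ′ ⊕ u ≡ u
    bracket≡u = begin
      (u ⊕ (x ′ ⊕ x)) ′ ⊕ u ≡⟨ cong (λ t → (u ⊕ t) ′ ⊕ u) (compl-left x) ⟩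
      (u ⊕ 𝟏) ′ ⊕ u         ≡⟨ cong (λ t → t ′ ⊕ u) (one-right u) ⟩
      𝟎 ⊕ u                 ≡⟨ zero-left u ⟩
      u                     ∎

  R-antitone : ∀ x y → R x y → R (y ′) (x ′)
  R-antitone x y x⊕y≡y = begin
    y ′ ⊕ x ′             ≡⟨ cong (λ t → t ′ ⊕ x ′) (sym x⊕y≡y) ⟩
    (x ⊕ y) ′ ⊕ x ′       ≡⟨ cong (λ t → (t ⊕ y) ′ ⊕ x ′) (sym (double-neg x)) ⟩
    (x ′ ′ ⊕ y) ′ ⊕ x ′   ≡⟨ absorption (x ′) y ⟩
    x ′                   ∎

lemma2p6 : {a : Level} (D : Algebra-2-1-0 a) → Satisfies-Axioms D →
    let open Algebra-2-1-0 D in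
    (𝟎 ′ ≡ 𝟏)
    × (∀ x y → ((x ′ ⊕ y) ′ ⊕ x) ≡ x)
    × (∀ x → R 𝟎 x × R x 𝟏)
    × (∀ x y → R x y → R (y ′) (x ′))
lemma2p6 D axioms =
  𝟎′≡𝟏 D axioms , absorption D axioms , (λ x → zero-left x , one-right x) , R-antitone D axioms
  where open Satisfies-Axioms axioms
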